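{- Let $m\geq 5$ and $n\geq 9$ be integers with $n\not\equiv 0 \pmod 5$. Then $\lambda_1^1(P_m \times C_n)\geq 5$.
   Context: For a graph $G$, an $L(1,1)$-labeling with labels in $\{0,1,\dots,p\}$ is a function $l:V(G)\to\{0,1,\dots,p\}$ such that $l(u)\neq l(v)$ whenever the distance $d(u,v)$ is $1$ or $2$. $\lambda_1^1(G)$ denotes the least $p$ for which $G$ admits such a labeling. $P_m$ denotes the path with $m$ vertices and $C_n$ the cycle with $n$ vertices. The direct product $G\times H$ has vertex set $V(G)\times V(H)$, with $(x_1,x_2)$ adjacent to $(y_1,y_2)$ iff $x_1y_1\in E(G)$ and $x_2y_2\in E(H)$. -}

module Defs where

open import Data.Nat using (ℕ; suc; _+_; NonZero)
open import Data.Nat.DivMod using (_%_)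
open import Data.Fin using (Fin; toℕ)
open import Data.Product using (_×_; Σ; ∃; _,_; proj₁; proj₂)
open import Data.Sum using (_⊎_)
open import Relation.Binary.PropositionalEquality using (_≡_; _≢_)

record Graph : Set₁ where
  field
    V   : Set
    Adj : V → V → Set
open Graph public

P : ℕ → Graph
P m = record { V = Fin m ; Adj = λ i j → (toℕ j ≡ suc (toℕ i)) ⊎ (toℕ i ≡ suc (toℕ j)) }

-- Cycle C_n on vertices 0..n-1 (intended n ≥ 3): i ~ j iff j ≡ i+1 (mod n) or i ≡ j+1 (mod n).
C : (n : ℕ) → .{{NonZero n}} → Graph
C n = record { V = Fin n
             ; Adj = λ i j → (toℕ j ≡ suc (toℕ i) % n) ⊎ (toℕ i ≡ suc (toℕ j) % n) }

_×ᴳ_ : Graph → Graph → Graph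
G ×ᴳ H = record { V = V G × V H
                ; Adj = λ x y → Adj G (proj₁ x) (proj₁ y) × Adj H (proj₂ x) (proj₂ y) }

Dist12 : (G : Graph) → V G → V G → Set
Dist12 G u v = (u ≢ v) × (Adj G u v ⊎ Σ (V G) (λ w → Adj G u w × Adj G w v))

IsL11Labeling : (G : Graph) (p : ℕ) → (V G → Fin (suc p)) → Set
IsL11Labeling G p l = ∀ u v → Dist12 G u v → l u ≢ l v

HasL11Labeling : Graph → ℕ → Set
HasL11Labeling G p = Σ (V G → Fin (suc p)) (IsL11Labeling G p)

-- Suppose P_m × C_n carries an L(1,1)-labelling with at most five colours. Its rows 0,…,4,
-- read from any column onwards, form a labelled copy of the strip P_5 × ℕ. In the strip each
-- vertex of rows 1–3 together with its four neighbours is a set of five vertices pairwise at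
-- distance at most 2, so every colour occurs in it. Chasing a colour c through these crosses,
-- c at (2,0) forces c at (1,3) or at its mirror image (3,3); from (1,3) it forces c at (3,7)
-- and then at (2,10). So row 2 is coloured 10-periodically, and n-periodically around the
-- cycle. As 5 ∤ n, Bézout's identity makes it 2-periodic, which is absurd because (2,0) and
-- (2,2) have the common neighbour (1,1).

module Submission where

open import Defs
open import Data.Nat as ℕ using (ℕ; _≤_; _%_; NonZero; zero; suc; _+_; _*_; _∸_; _<_; _/_; z≤n; s≤s)
open import Data.Nat.Properties
  using (≤-trans; 1+n≢n; <⇒≢; <⇒≱; ≰⇒>; n≤1+n; +-assoc; +-comm; +-cancelˡ-≡; +-∸-assoc)
open import Data.Nat.DivMod using (_mod_; m≡m%n+[m/n]*n; [m+kn]%n≡m%n; %-remove-+ˡ)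
open import Data.Nat.Divisibility using (_∣_; _∤_; n∣m⇒m%n≡0; divides; ∣-refl; ∣⇒≤; ∣m+n∣m⇒∣n; n∣m*n)
open import Data.Nat.Coprimality using (Coprime; coprime-Bézout)
open import Data.Nat.GCD using (module Bézout)
open import Data.Nat.Primality using (Prime; prime?; prime⇒irreducible)
open import Data.Nat.Solver using (module +-*-Solver)
open import Data.Fin as Fin using (Fin; toℕ; zero; suc; inject≤; opposite; punchOut; #_)
open import Data.Fin.Properties
  using (toℕ-fromℕ<; toℕ-injective; toℕ<n; toℕ-inject≤; inject≤-injective; opposite-prop;
         opposite-involutive; punchOut-injective; injective⇒≤; any?)
open import Data.Vec using (Vec; []; _∷_; map)
open import Data.Vec.Relation.Unary.AllPairs as AllPairs using (AllPairs; []; _∷_)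
import Data.Vec.Relation.Unary.AllPairs.Properties as AllPairs
open import Data.Vec.Relation.Unary.Unique.Propositional.Properties using (lookup-injective)
open import Data.Vec.Relation.Unary.All using ([]; _∷_)
open import Data.Product using (∃; _,_; proj₁; proj₂)
open import Data.Product.Properties using (≡-dec)
open import Data.Sum using (_⊎_; inj₁; inj₂; swap)
open import Data.Empty using (⊥; ⊥-elim)
open import Function using (_∘_; id)
open import Function.Definitions using (Injective)
open import Relation.Nullary using (Dec; yes; no; ¬_; contradiction)
open import Relation.Nullary.Decidable
  using (True; False; toWitness; toWitnessFalse; from-yes; _×-dec_; _⊎-dec_)
open import Relation.Binary.PropositionalEquality
  using (_≡_; _≢_; refl; sym; trans; cong; cong₂; subst; module ≡-Reasoning)

injective⇒onto : ∀ {m n} {f : Fin n → Fin (suc m)} → Injective _≡_ _≡_ f → m < n → ∀ c → ∃ λ k → f k ≡ c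
injective⇒onto {m} {n} {f} f-injective m<n c with any? (λ k → f k Fin.≟ c)
... | yes hit = hit
... | no miss = contradiction (injective⇒≤ punched-injective) (<⇒≱ m<n)
  where
  missed : ∀ k → c ≢ f k
  missed k c≡fk = miss (k , sym c≡fk)
  punched : Fin n → Fin m
  punched k = punchOut (missed k)
  punched-injective : Injective _≡_ _≡_ punched
  punched-injective {j} {k} eq = f-injective (punchOut-injective (missed j) (missed k) eq)

module _ {n : ℕ} .{{_ : NonZero n}} where

  toℕ-mod : ∀ s → toℕ (s mod n) ≡ s % n
  toℕ-mod s = toℕ-fromℕ< _

  mod-periodic : ∀ s → (n + s) mod n ≡ s mod n
  mod-periodic s = toℕ-injective (trans (toℕ-mod (n + s)) (trans (%-remove-+ˡ s ∣-refl) (sym (toℕ-mod s))))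

  mod-suc : ∀ s → toℕ (suc s mod n) ≡ suc (toℕ (s mod n)) % n
  mod-suc s = begin
    toℕ (suc s mod n)             ≡⟨ toℕ-mod (suc s) ⟩
    suc s % n                     ≡⟨ cong (λ x → suc x % n) (m≡m%n+[m/n]*n s n) ⟩
    suc (s % n + s / n * n) % n   ≡⟨ [m+kn]%n≡m%n (suc (s % n)) (s / n) n ⟩
    suc (s % n) % n               ≡⟨ cong (λ x → suc x % n) (toℕ-mod s) ⟨
    suc (toℕ (s mod n)) % n       ∎
    where open ≡-Reasoning

  -- d + s and s have the same residue, so n divides d.
  mod-shift-≢ : ∀ {d} s .{{_ : NonZero d}} → d < n → (d + s) mod n ≢ s mod n
  mod-shift-≢ {d} s d<n eq = <⇒≱ d<n (∣⇒≤ (∣m+n∣m⇒∣n n∣[s/n]n+d (n∣m*n (s / n))))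
    where
    r = s % n
    same-residue : (d + s) % n ≡ r
    same-residue = trans (sym (toℕ-mod (d + s))) (trans (cong toℕ eq) (toℕ-mod s))
    shifted : r + (s / n * n + d) ≡ r + (d + s) / n * n
    shifted = begin
      r + (s / n * n + d)            ≡⟨ +-assoc r _ d ⟨
      r + s / n * n + d              ≡⟨ cong (_+ d) (m≡m%n+[m/n]*n s n) ⟨
      s + d                          ≡⟨ +-comm s d ⟩
      d + s                          ≡⟨ m≡m%n+[m/n]*n (d + s) n ⟩
      (d + s) % n + (d + s) / n * n  ≡⟨ cong (_+ (d + s) / n * n) same-residue ⟩
      r + (d + s) / n * n            ∎
      where open ≡-Reasoning
    n∣[s/n]n+d : n ∣ s / n * n + d
    n∣[s/n]n+d = divides ((d + s) / n) (+-cancelˡ-≡ r _ _ shifted)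

Bézout-scaled : ∀ k x y {d m n} → d + y * n ≡ x * m → x * (k * m) ≡ y * (k * n) + k * d
Bézout-scaled k x y {d} {m} {n} eq = begin
  x * (k * m)        ≡⟨ solve 3 (λ k x m → x :* (k :* m) := k :* (x :* m)) refl k x m ⟩
  k * (x * m)        ≡⟨ cong (k *_) eq ⟨
  k * (d + y * n)    ≡⟨ solve 4 (λ k d y n → k :* (d :+ y :* n) := y :* (k :* n) :+ k :* d) refl k d y n ⟩
  y * (k * n) + k * d ∎
  where open ≡-Reasoning
        open +-*-Solver

Periodic : ∀ {a} {A : Set a} → (ℕ → A) → ℕ → Set a
Periodic h a = ∀ t → h (a + t) ≡ h t

module _ {a} {A : Set a} {h : ℕ → A} where

  periodic-+ : ∀ {b c} → Periodic h b → Periodic h c → Periodic h (b + c)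
  periodic-+ {b} {c} hb hc t = trans (cong h (+-assoc b c t)) (trans (hb (c + t)) (hc t))

  periodic-* : ∀ {b} → Periodic h b → ∀ k → Periodic h (k * b)
  periodic-* hb zero    t = refl
  periodic-* hb (suc k) = periodic-+ hb (periodic-* hb k)

  periodic-cancelˡ : ∀ {b c} → Periodic h b → Periodic h (b + c) → Periodic h c
  periodic-cancelˡ {b} {c} hb hbc t =
    trans (sym (hb (c + t))) (trans (cong h (sym (+-assoc b c t))) (hbc t))

  periodic-Bézout : ∀ {k m n d} → Periodic h (k * m) → Periodic h (k * n) → Bézout.Identity d m n →
                    Periodic h (k * d)
  periodic-Bézout {k} hm hn (Bézout.+- x y eq) =
    periodic-cancelˡ (periodic-* hn y) (subst (Periodic h) (Bézout-scaled k x y eq) (periodic-* hm x))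
  periodic-Bézout {k} hm hn (Bézout.-+ x y eq) =
    periodic-cancelˡ (periodic-* hm x) (subst (Periodic h) (Bézout-scaled k y x eq) (periodic-* hn y))

prime∤⇒coprime : ∀ {q n} → Prime q → q ∤ n → Coprime q n
prime∤⇒coprime q-prime q∤n (d∣q , d∣n) with prime⇒irreducible q-prime d∣q
... | inj₁ d≡1 = d≡1
... | inj₂ refl = contradiction d∣n q∤n

IsL11Labeling-pullback : ∀ {G H : Graph} {p} {l : V G → Fin (suc p)} (φ : V H → V G) →
  (∀ {u v} → Adj H u v → Adj G (φ u) (φ v)) →
  (∀ {u v} → Dist12 H u v → φ u ≢ φ v) →
  IsL11Labeling G p l → IsL11Labeling H p (l ∘ φ)
IsL11Labeling-pullback φ φ-adj φ-sep l-L11 u v d@(_ , inj₁ uv) =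
  l-L11 (φ u) (φ v) (φ-sep d , inj₁ (φ-adj uv))
IsL11Labeling-pullback φ φ-adj φ-sep l-L11 u v d@(_ , inj₂ (w , uw , wv)) =
  l-L11 (φ u) (φ v) (φ-sep d , inj₂ (φ w , φ-adj uw , φ-adj wv))

P-irreflexive : ∀ {k} {i j : Fin k} → Adj (P k) i j → i ≢ j
P-irreflexive (inj₁ j≡1+i) refl = 1+n≢n (sym j≡1+i)
P-irreflexive (inj₂ i≡1+j) refl = 1+n≢n (sym i≡1+j)

P-inject≤ : ∀ {k m} (k≤m : k ≤ m) {i j : Fin k} → Adj (P k) i j → Adj (P m) (inject≤ i k≤m) (inject≤ j k≤m)
P-inject≤ k≤m {i} {j} rewrite toℕ-inject≤ i k≤m | toℕ-inject≤ j k≤m = id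

opposite-suc : ∀ {k} {i j : Fin k} → toℕ j ≡ suc (toℕ i) → toℕ (opposite i) ≡ suc (toℕ (opposite j))
opposite-suc {k} {i} {j} j≡1+i = begin
  toℕ (opposite i)       ≡⟨ opposite-prop i ⟩
  k ∸ suc (toℕ i)        ≡⟨ cong (k ∸_) (sym j≡1+i) ⟩
  k ∸ toℕ j              ≡⟨ +-∸-assoc 1 (toℕ<n j) ⟩
  suc (k ∸ suc (toℕ j))  ≡⟨ cong suc (sym (opposite-prop j)) ⟩
  suc (toℕ (opposite j)) ∎
  where open ≡-Reasoning

P-opposite : ∀ {k} {i j : Fin k} → Adj (P k) i j → Adj (P k) (opposite i) (opposite j)
P-opposite (inj₁ j≡1+i) = inj₂ (opposite-suc j≡1+i)
P-opposite (inj₂ i≡1+j) = inj₁ (opposite-suc i≡1+j)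

Ray : Graph
Ray = record { V = ℕ ; Adj = λ s t → (t ≡ suc s) ⊎ (s ≡ suc t) }

Ray-two-steps : ∀ {s t u} → Adj Ray s t → Adj Ray t u → (u ≡ 2 + s) ⊎ (u ≡ s) ⊎ (s ≡ 2 + u)
Ray-two-steps (inj₁ refl) (inj₁ refl) = inj₁ refl
Ray-two-steps (inj₁ refl) (inj₂ refl) = inj₂ (inj₁ refl)
Ray-two-steps (inj₂ refl) (inj₁ refl) = inj₂ (inj₁ refl)
Ray-two-steps (inj₂ refl) (inj₂ refl) = inj₂ (inj₂ refl)

Strip : ℕ → Graph
Strip k = P k ×ᴳ Ray

module _ {k : ℕ} where

  Strip-sym : ∀ {u v : V (Strip k)} → Adj (Strip k) u v → Adj (Strip k) v u
  Strip-sym (row , column) = swap row , swap column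

  Strip-irreflexive : ∀ {u v : V (Strip k)} → Adj (Strip k) u v → u ≢ v
  Strip-irreflexive (row , _) u≡v = P-irreflexive row (cong proj₁ u≡v)

  adjacent? : (u v : V (Strip k)) → Dec (Adj (Strip k) u v)
  adjacent? (i , s) (j , t) =
    ((toℕ j ℕ.≟ suc (toℕ i)) ⊎-dec (toℕ i ℕ.≟ suc (toℕ j))) ×-dec ((t ℕ.≟ suc s) ⊎-dec (s ℕ.≟ suc t))

  _≟_ : (u v : V (Strip k)) → Dec (u ≡ v)
  _≟_ = ≡-dec Fin._≟_ ℕ._≟_

  byEdge : ∀ {u v} → {True (adjacent? u v)} → Dist12 (Strip k) u v
  byEdge {u} {v} {uv} = Strip-irreflexive uv′ , inj₁ uv′
    where uv′ = toWitness {a? = adjacent? u v} uv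

  via : ∀ {u v} (w : V (Strip k)) → {True (adjacent? u w)} → {True (adjacent? w v)} → {False (u ≟ v)} →
        Dist12 (Strip k) u v
  via {u} {v} w {uw} {wv} {u≢v} =
    toWitnessFalse {a? = u ≟ v} u≢v , inj₂ (w , toWitness {a? = adjacent? u w} uw , toWitness {a? = adjacent? w v} wv)

  reflect : V (Strip k) → V (Strip k)
  reflect (i , t) = opposite i , t

  reflect-injective : Injective _≡_ _≡_ reflect
  reflect-injective {i , s} {j , t} eq =
    cong₂ _,_ (trans (sym (opposite-involutive i)) (trans (cong (opposite ∘ proj₁) eq) (opposite-involutive j)))
              (cong proj₂ eq)

  IsL11Labeling-reflect : ∀ {p f} → IsL11Labeling (Strip k) p f → IsL11Labeling (Strip k) p (f ∘ reflect)
  IsL11Labeling-reflect = IsL11Labeling-pullback reflect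
    (λ (row , column) → P-opposite row , column)
    (λ (u≢v , _) → u≢v ∘ reflect-injective)

  cross : (i₋ i i₊ : Fin k) → ℕ → Vec (V (Strip k)) 5
  cross i₋ i i₊ t = (i , suc t) ∷ (i₋ , t) ∷ (i₋ , 2 + t) ∷ (i₊ , t) ∷ (i₊ , 2 + t) ∷ []

  cross-Dist12 : ∀ {i₋ i i₊ : Fin k} {t} → toℕ i ≡ suc (toℕ i₋) → toℕ i₊ ≡ suc (toℕ i) →
                 AllPairs (Dist12 (Strip k)) (cross i₋ i i₊ t)
  cross-Dist12 {i₋} {i} {i₊} {t} down up =
      (spoke to-sw ∷ spoke to-se ∷ spoke to-nw ∷ spoke to-ne ∷ [])
    ∷ (rim to-sw to-se columns ∷ rim to-sw to-nw rows ∷ rim to-sw to-ne columns ∷ [])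
    ∷ (rim to-se to-nw (columns ∘ sym) ∷ rim to-se to-ne rows ∷ [])
    ∷ (rim to-nw to-ne columns ∷ [])
    ∷ []
    ∷ []
    where
    centre = (i , suc t)
    to-sw : Adj (Strip k) centre (i₋ , t)
    to-sw = inj₂ down , inj₂ refl
    to-se : Adj (Strip k) centre (i₋ , 2 + t)
    to-se = inj₂ down , inj₁ refl
    to-nw : Adj (Strip k) centre (i₊ , t)
    to-nw = inj₁ up , inj₂ refl
    to-ne : Adj (Strip k) centre (i₊ , 2 + t)
    to-ne = inj₁ up , inj₁ refl
    spoke : ∀ {u} → Adj (Strip k) centre u → Dist12 (Strip k) centre u
    spoke cu = Strip-irreflexive cu , inj₁ cu
    rim : ∀ {u v} → Adj (Strip k) centre u → Adj (Strip k) centre v → u ≢ v → Dist12 (Strip k) u v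
    rim cu cv u≢v = u≢v , inj₂ (centre , Strip-sym cu , cv)
    n≢2+n : ∀ n → n ≢ 2 + n
    n≢2+n n = <⇒≢ (s≤s (n≤1+n n))
    columns : ∀ {j j′ : Fin k} → (j , t) ≢ (j′ , 2 + t)
    columns eq = n≢2+n t (cong proj₂ eq)
    rows : ∀ {s u} → (i₋ , s) ≢ (i₊ , u)
    rows eq = n≢2+n (toℕ i₋) (trans (cong (toℕ ∘ proj₁) eq) (trans up (cong suc down)))

r₀ r₁ r₂ r₃ r₄ : Fin 5
r₀ = # 0
r₁ = # 1
r₂ = # 2
r₃ = # 3
r₄ = # 4

module FiveColours {p} (p<5 : p < 5) {f : V (Strip 5) → Fin (suc p)} (f-L11 : IsL11Labeling (Strip 5) p f) where

  infix 4 _at_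
  _at_ : Fin (suc p) → V (Strip 5) → Set
  c at u = f u ≡ c

  clash : ∀ {c u v} → c at u → c at v → Dist12 (Strip 5) u v → ⊥
  clash cu cv d = f-L11 _ _ d (trans cu (sym cv))

  data Hit (c : Fin (suc p)) (i₋ i i₊ : Fin 5) (t : ℕ) : Set where
    centre : c at (i , 1 + t)  → Hit c i₋ i i₊ t
    sw     : c at (i₋ , t)     → Hit c i₋ i i₊ t
    se     : c at (i₋ , 2 + t) → Hit c i₋ i i₊ t
    nw     : c at (i₊ , t)     → Hit c i₋ i i₊ t
    ne     : c at (i₊ , 2 + t) → Hit c i₋ i i₊ t

  cross-rainbow : ∀ {i₋ i i₊ : Fin 5} {t} → toℕ i ≡ suc (toℕ i₋) → toℕ i₊ ≡ suc (toℕ i) →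
                  AllPairs _≢_ (map f (cross i₋ i i₊ t))
  cross-rainbow down up = AllPairs.map⁺ (AllPairs.map (f-L11 _ _) (cross-Dist12 down up))

  -- A cross shows five distinct colours out of at most five.
  hit : ∀ c (i₋ i i₊ : Fin 5) t → toℕ i ≡ suc (toℕ i₋) → toℕ i₊ ≡ suc (toℕ i) → Hit c i₋ i i₊ t
  hit c i₋ i i₊ t down up with injective⇒onto (lookup-injective (cross-rainbow down up) _ _) p<5 c
  ... | zero , q                            = centre q
  ... | suc zero , q                        = sw q
  ... | suc (suc zero) , q                  = se q
  ... | suc (suc (suc zero)) , q            = nw q
  ... | suc (suc (suc (suc zero))) , q      = ne q

  module _ {c : Fin (suc p)} where

    leaves-row₂ : c at (r₂ , 0) → c at (r₁ , 3) ⊎ c at (r₃ , 3)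
    leaves-row₂ q₀ with hit c r₁ r₂ r₃ 1 refl refl
    ... | centre q = ⊥-elim (clash q₀ q (via (r₁ , 1)))
    ... | sw q     = ⊥-elim (clash q₀ q byEdge)
    ... | se q     = inj₁ q
    ... | nw q     = ⊥-elim (clash q₀ q byEdge)
    ... | ne q     = inj₂ q

    after-[1,3] : c at (r₁ , 3) → c at (r₀ , 6) ⊎ c at (r₂ , 6)
    after-[1,3] q₃ with hit c r₀ r₁ r₂ 4 refl refl
    ... | centre q = ⊥-elim (clash q₃ q (via (r₀ , 4)))
    ... | sw q     = ⊥-elim (clash q₃ q byEdge)
    ... | se q     = inj₁ q
    ... | nw q     = ⊥-elim (clash q₃ q byEdge)
    ... | ne q     = inj₂ q

    avoids-[2,6] : c at (r₂ , 0) → c at (r₁ , 3) → ¬ c at (r₂ , 6)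
    avoids-[2,6] q₀ q₃ q₆ with hit c r₂ r₃ r₄ 2 refl refl
    ... | centre q = clash q₃ q (via (r₂ , 2))
    ... | sw q     = clash q₀ q (via (r₁ , 1))
    ... | se q     = clash q₃ q byEdge
    ... | nw q     = clash q₀ q (via (r₃ , 1))
    ... | ne q     = clash q q₆ (via (r₃ , 5))

    avoids-[1,7] : c at (r₁ , 3) → ¬ c at (r₁ , 7)
    avoids-[1,7] q₃ q₇ with after-[1,3] q₃
    ... | inj₁ q = clash q q₇ byEdge
    ... | inj₂ q = clash q q₇ byEdge

    crosses-to-row₃ : c at (r₂ , 0) → c at (r₁ , 3) → c at (r₃ , 7)
    crosses-to-row₃ q₀ q₃ with hit c r₁ r₂ r₃ 5 refl refl
    ... | centre q = ⊥-elim (avoids-[2,6] q₀ q₃ q)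
    ... | sw q     = ⊥-elim (clash q₃ q (via (r₂ , 4)))
    ... | se q     = ⊥-elim (avoids-[1,7] q₃ q)
    ... | nw q     = ⊥-elim (clash q₃ q (via (r₂ , 4)))
    ... | ne q     = q

    reaches-[0,6] : c at (r₁ , 3) → c at (r₃ , 7) → c at (r₀ , 6)
    reaches-[0,6] q₃ q₇ with after-[1,3] q₃
    ... | inj₁ q = q
    ... | inj₂ q = ⊥-elim (clash q q₇ byEdge)

    avoids-[1,11] : c at (r₁ , 3) → c at (r₃ , 7) → ¬ c at (r₁ , 11)
    avoids-[1,11] q₃ q₇ q₁₁ with hit c r₀ r₁ r₂ 8 refl refl
    ... | centre q = clash q q₁₁ (via (r₀ , 10))
    ... | sw q     = clash (reaches-[0,6] q₃ q₇) q (via (r₁ , 7))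
    ... | se q     = clash q q₁₁ byEdge
    ... | nw q     = clash q₇ q byEdge
    ... | ne q     = clash q q₁₁ byEdge

    avoids-[3,11] : c at (r₃ , 7) → ¬ c at (r₃ , 11)
    avoids-[3,11] q₇ q₁₁ with hit c r₂ r₃ r₄ 8 refl refl
    ... | centre q = clash q₇ q (via (r₂ , 8))
    ... | sw q     = clash q₇ q byEdge
    ... | se q     = clash q q₁₁ byEdge
    ... | nw q     = clash q₇ q byEdge
    ... | ne q     = clash q q₁₁ byEdge

    returns-to-row₂ : c at (r₁ , 3) → c at (r₃ , 7) → c at (r₂ , 10)
    returns-to-row₂ q₃ q₇ with hit c r₁ r₂ r₃ 9 refl refl
    ... | centre q = q
    ... | sw q     = ⊥-elim (clash q₇ q (via (r₂ , 8)))
    ... | se q     = ⊥-elim (avoids-[1,11] q₃ q₇ q)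
    ... | nw q     = ⊥-elim (clash q₇ q (via (r₂ , 8)))
    ... | ne q     = ⊥-elim (avoids-[3,11] q₇ q)

strip-period : ∀ {p} → p < 5 → {f : V (Strip 5) → Fin (suc p)} → IsL11Labeling (Strip 5) p f →
               f (r₂ , 10) ≡ f (r₂ , 0)
strip-period p<5 f-L11 with FiveColours.leaves-row₂ p<5 f-L11 refl
... | inj₁ q = returns-to-row₂ q (crosses-to-row₃ refl q)
  where open FiveColours p<5 f-L11
... | inj₂ q = returns-to-row₂ q (crosses-to-row₃ refl q)
  -- (3,3) is the mirror image of (1,3) under the reflection i ↦ 4 − i of the rows.
  where open FiveColours p<5 (IsL11Labeling-reflect f-L11)

module _ {k m n : ℕ} .{{_ : NonZero n}} (k≤m : k ≤ m) (2<n : 2 < n) where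

  wrap : ℕ → V (Strip k) → V (P m ×ᴳ C n)
  wrap j (i , t) = inject≤ i k≤m , (t + j) mod n

  wrap-adj : ∀ j {u v} → Adj (Strip k) u v → Adj (P m ×ᴳ C n) (wrap j u) (wrap j v)
  wrap-adj j (row , inj₁ refl) = P-inject≤ k≤m row , inj₁ (mod-suc _)
  wrap-adj j (row , inj₂ refl) = P-inject≤ k≤m row , inj₂ (mod-suc _)

  wrap-separates : ∀ j {u v} → Dist12 (Strip k) u v → wrap j u ≢ wrap j v
  wrap-separates j {i , s} {i′ , t} (u≢v , inj₁ (row , _)) eq =
    P-irreflexive row (inject≤-injective k≤m k≤m i i′ (cong proj₁ eq))
  wrap-separates j {i , s} {i′ , t} (u≢v , inj₂ (_ , (_ , s~) , (_ , ~t))) eq with Ray-two-steps s~ ~t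
  ... | inj₁ refl        = mod-shift-≢ (s + j) 2<n (sym (cong proj₂ eq))
  ... | inj₂ (inj₁ refl) = u≢v (cong (_, s) (inject≤-injective k≤m k≤m i i′ (cong proj₁ eq)))
  ... | inj₂ (inj₂ refl) = mod-shift-≢ (t + j) 2<n (cong proj₂ eq)

  IsL11Labeling-wrap : ∀ {p l} j → IsL11Labeling (P m ×ᴳ C n) p l → IsL11Labeling (Strip k) p (l ∘ wrap j)
  IsL11Labeling-wrap j = IsL11Labeling-pullback (wrap j) (wrap-adj j) (wrap-separates j)

P×C-λ₁¹≥5 : ∀ {m n p} .{{_ : NonZero n}} → 5 ≤ m → 2 < n → 5 ∤ n → HasL11Labeling (P m ×ᴳ C n) p → 5 ≤ p
P×C-λ₁¹≥5 {n = n} {p} 5≤m 2<n 5∤n (l , l-L11) with 5 ℕ.≤? p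
... | yes 5≤p = 5≤p
... | no  5≰p = ⊥-elim (strip 0 (r₂ , 2) (r₂ , 0) (via (r₁ , 1)) (period₂ 0))
  where
  strip : ∀ j → IsL11Labeling (Strip 5) p (l ∘ wrap 5≤m 2<n j)
  strip j = IsL11Labeling-wrap 5≤m 2<n j l-L11
  row₂ : ℕ → Fin (suc p)
  row₂ s = l (inject≤ r₂ 5≤m , s mod n)
  period₁₀ : Periodic row₂ 10
  period₁₀ j = strip-period (≰⇒> 5≰p) (strip j)
  periodₙ : Periodic row₂ n
  periodₙ s = cong (λ x → l (inject≤ r₂ 5≤m , x)) (mod-periodic s)
  period₂ : Periodic row₂ 2
  period₂ = periodic-Bézout {k = 2} period₁₀ (periodic-* periodₙ 2)
    (coprime-Bézout (prime∤⇒coprime (from-yes (prime? 5)) 5∤n))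

mainTheorem18 : (m n : ℕ) → 5 ≤ m → 9 ≤ n → .{{_ : NonZero n}} → n % 5 ≢ 0 →
    (p : ℕ) → HasL11Labeling (P m ×ᴳ C n) p → 5 ≤ p
mainTheorem18 m n 5≤m 9≤n n%5≢0 p =
  P×C-λ₁¹≥5 5≤m (≤-trans (s≤s (s≤s (s≤s z≤n))) 9≤n) (n%5≢0 ∘ n∣m⇒m%n≡0 n 5)
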